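{- Let $n$ and $k$ be positive integers and let $\mathcal{H}$ be a generic $n\times n$ half-grid in $\mathbb{R}^2$ with vertex $V$. Let $\mathrm{cov}_k(\mathcal{H})$ be the minimum size of a finite multiset of lines in $\mathbb{R}^2$, none of which passes through $V$, such that every point of $\mathcal{H}\setminus\{V\}$ lies on at least $k$ of the lines (counted with multiplicity). Then $$\frac{3nk}{2}-2k\ \le\ \mathrm{cov}_k(\mathcal{H})\ \le\ \frac{3nk}{2}+\frac{k}{2}.$$
   Context: Let $S_1=\{a_0<a_1<\cdots<a_{n-1}\}$ and $S_2=\{b_0<b_1<\cdots<b_{n-1}\}$ be sets of $n$ real numbers each. The $n\times n$ half-grid $\mathcal{H}$ defined by $S_1,S_2$ is the set of points $(a_i,b_j)$ with $i,j\ge 0$ and $i+j\le n-1$. Its vertex is $V=(a_0,b_0)$. The half-grid is called generic if every line in $\mathbb{R}^2$ that is parallel to neither the $x$-axis nor the $y$-axis passes through at most $2$ points of $\mathcal{H}$. -}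

module Defs where

open import Data.Nat as ℕ using (ℕ; zero; suc)
open import Data.Fin using (Fin; toℕ)
open import Data.List using (List; length; lookup)
open import Data.Product using (Σ; ∃; _×_; _,_)
open import Data.Sum using (_⊎_)
open import Data.Empty using (⊥)
open import Relation.Nullary using (¬_)
open import Relation.Binary.PropositionalEquality using (_≡_; _≢_)
open import Function.Definitions using (Injective)

-- The real numbers, given axiomatically: a complete ordered field.
-- (agda-stdlib has no reals; any model of these axioms is isomorphic
--  to ℝ, so quantifying over all models states the result for ℝ.)

record RealField : Set₁ where
  infixl 6 _+_
  infixl 7 _*_
  infix  4 _<_ _≤_
  field
    Carrier : Set
    _+_ _*_ : Carrier → Carrier → Carrier
    -_      : Carrier → Carrier
    0# 1#   : Carrier
    _<_     : Carrier → Carrier → Set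
    +-assoc   : ∀ x y z → (x + y) + z ≡ x + (y + z)
    +-comm    : ∀ x y → x + y ≡ y + x
    +-identityˡ : ∀ x → 0# + x ≡ x
    -‿inverseˡ : ∀ x → (- x) + x ≡ 0#
    *-assoc   : ∀ x y z → (x * y) * z ≡ x * (y * z)
    *-comm    : ∀ x y → x * y ≡ y * x
    *-identityˡ : ∀ x → 1# * x ≡ x
    distribˡ  : ∀ x y z → x * (y + z) ≡ (x * y) + (x * z)
    0≢1       : 0# ≢ 1#
    inverse   : ∀ x → x ≢ 0# → Σ Carrier (λ y → x * y ≡ 1#)
    <-irrefl  : ∀ x → ¬ (x < x)
    <-trans   : ∀ {x y z} → x < y → y < z → x < z
    <-trichotomy : ∀ x y → (x < y) ⊎ (x ≡ y) ⊎ (y < x)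
    +-mono-<  : ∀ {x y} z → x < y → x + z < y + z
    *-pos     : ∀ {x y} → 0# < x → 0# < y → 0# < x * y
  _≤_ : Carrier → Carrier → Set
  x ≤ y = (x < y) ⊎ (x ≡ y)
  field
    completeness : (P : Carrier → Set) → ∃ P → ∃ (λ u → ∀ x → P x → x ≤ u) →
                   ∃ (λ s → (∀ x → P x → x ≤ s) × (∀ u → (∀ x → P x → x ≤ u) → s ≤ u))

module _ (R : RealField) where
  open RealField R

  record Line : Set where
    field
      α β γ : Carrier
      nondeg : ¬ (α ≡ 0# × β ≡ 0#)
  open Line public

  OnLine : Line → Carrier → Carrier → Set
  OnLine ℓ x y = α ℓ * x + β ℓ * y ≡ γ ℓ

  StrictlyIncreasing : {n : ℕ} → (Fin n → Carrier) → Set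
  StrictlyIncreasing {n} a = ∀ (i j : Fin n) → toℕ i ℕ.< toℕ j → a i < a j

  InHalf : (n : ℕ) → Fin n → Fin n → Set
  InHalf n i j = toℕ i ℕ.+ toℕ j ℕ.< n

  module _ {n : ℕ} (a b : Fin n → Carrier) where

    PtOn : Line → Fin n → Fin n → Set
    PtOn ℓ i j = OnLine ℓ (a i) (b j)

    Generic : Set
    Generic = ∀ (ℓ : Line) → α ℓ ≢ 0# → β ℓ ≢ 0# →
      ∀ (i₁ j₁ i₂ j₂ i₃ j₃ : Fin n) →
      InHalf n i₁ j₁ → InHalf n i₂ j₂ → InHalf n i₃ j₃ →
      PtOn ℓ i₁ j₁ → PtOn ℓ i₂ j₂ → PtOn ℓ i₃ j₃ →
      ((i₁ , j₁) ≡ (i₂ , j₂)) ⊎ ((i₁ , j₁) ≡ (i₃ , j₃)) ⊎ ((i₂ , j₂) ≡ (i₃ , j₃))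

    ThroughVertex : Line → Set
    ThroughVertex ℓ = ∃ λ (i : Fin n) → ∃ λ (j : Fin n) →
      toℕ i ≡ 0 × toℕ j ≡ 0 × PtOn ℓ i j

    AvoidsVertex : List Line → Set
    AvoidsVertex L = ∀ (t : Fin (length L)) → ¬ ThroughVertex (lookup L t)

    -- Point (a_i,b_j) lies on at least k lines of L, counted with multiplicity:
    -- there are k distinct positions of L whose lines contain it.
    OnAtLeast : ℕ → List Line → Fin n → Fin n → Set
    OnAtLeast k L i j = Σ (Fin k → Fin (length L)) λ f →
      Injective _≡_ _≡_ f × (∀ t → PtOn (lookup L (f t)) i j)

    KCover : ℕ → List Line → Set
    KCover k L = ∀ (i j : Fin n) → InHalf n i j → ¬ (toℕ i ≡ 0 × toℕ j ≡ 0) →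
      OnAtLeast k L i j

{-# OPTIONS --safe #-}
-- The 3n − 4 boundary points of the half-grid other than V (the two legs and the
-- inside of the hypotenuse i + j = n − 1) meet every line missing V at most twice: a line
-- parallel to neither axis by genericity, a vertical line x = aᵢ (i ≠ 0) only in (i, 0) and
-- (i, n − 1 − i), and symmetrically for horizontal lines. Counting the incidences between these
-- points and a k-fold cover L in two ways gives k (3n − 4) ≤ 2 |L|.
--
-- Let q = ⌈(n − 1)/2⌉. The lines x = aᵣ and y = bᵣ for 1 ≤ r ≤ q, and the lines
-- through (aᵣ, b₀) and (a₀, bᵣ) for n − q ≤ r ≤ n − 1, which miss V by genericity, cover H ∖ {V}:
-- a point with no coordinate in [1, q] cannot have both coordinates above q since i + j < n, so
-- it is (r, 0) or (0, r) with r > q ≥ n − 1 − q. Taking these 3q ≤ 3n/2 lines k times gives the bound.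
module Submission where

open import Defs
open import Algebra.Bundles using (CommutativeRing)
open import Algebra.Consequences.Propositional using (comm∧idˡ⇒id; comm∧invˡ⇒inv; comm∧distrˡ⇒distr)
open import Data.Empty using (⊥-elim)
open import Data.Fin as Fin using (Fin; zero; suc; toℕ; fromℕ<; inject₁; inject≤; opposite; punchIn; punchOut)
import Data.Fin.Properties as Fin
open import Data.List using (List; []; _∷_; _++_; length; lookup; filter; concat; replicate; map; tabulate)
open import Data.List.Membership.Propositional using (_∈_; lose)
open import Data.List.Membership.Propositional.Properties
  using (∈-filter⁻; ∈-++⁻; ∈-++⁺ˡ; ∈-++⁺ʳ; ∈-map⁺; ∈-tabulate⁺; ∈-tabulate⁻; ∈-lookup)
open import Data.List.Properties using (filter-++; filter-some; length-++; length-map; length-tabulate)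
open import Data.List.Relation.Unary.All as All using (All; []; _∷_)
import Data.List.Relation.Unary.All.Properties as All
open import Data.List.Relation.Unary.AllPairs using ([]; _∷_)
open import Data.List.Relation.Unary.Any using (here; there; index)
open import Data.List.Relation.Unary.Any.Properties using (lookup-index)
open import Data.List.Relation.Unary.Unique.Propositional using (Unique)
import Data.List.Relation.Unary.Unique.Propositional.Properties as Unique
open import Data.Nat using (ℕ; zero; suc; z≤n; s≤s; s≤s⁻¹; _<?_; ⌈_/2⌉; ⌊_/2⌋)
import Data.Nat.Properties as ℕ
open import Data.Nat.ListAction using (sum)
open import Data.Nat.Tactic.RingSolver using (solve-∀)
open import Data.Product using (Σ; _×_; _,_; proj₁; proj₂)
open import Data.Sum using (_⊎_; inj₁; inj₂)
open import Function using (_∘_)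
open import Function.Definitions using (Injective)
open import Level using (0ℓ)
open import Relation.Binary.Definitions using (DecidableEquality; tri<; tri≈; tri>)
open import Relation.Binary.PropositionalEquality
open import Relation.Nullary using (¬_; Dec; yes; no)
open import Relation.Unary using (Decidable)

module ListCounting where
  open import Data.Nat using (_+_; _*_; _≤_)
  open import Algebra.Properties.CommutativeSemigroup ℕ.+-commutativeSemigroup using (x∙yz≈y∙xz)

  private
    variable
      A B : Set
      P Q : A → Set
      k : ℕ
      x y z : A
      xs : List A

  TwoEqual : A → A → A → Set
  TwoEqual x y z = x ≡ y ⊎ x ≡ z ⊎ y ≡ z

  TwoEqual-map : (f : A → B) → TwoEqual x y z → TwoEqual (f x) (f y) (f z)
  TwoEqual-map f (inj₁ x≡y)        = inj₁ (cong f x≡y)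
  TwoEqual-map f (inj₂ (inj₁ x≡z)) = inj₂ (inj₁ (cong f x≡z))
  TwoEqual-map f (inj₂ (inj₂ y≡z)) = inj₂ (inj₂ (cong f y≡z))

  pigeonhole₃ :
    (∀ {x y} → P x → P y → x ≡ y) → (∀ {x y} → Q x → Q y → x ≡ y) →
    P x ⊎ Q x → P y ⊎ Q y → P z ⊎ Q z → TwoEqual x y z
  pigeonhole₃ P-unique Q-unique (inj₁ px) (inj₁ py) _         = inj₁ (P-unique px py)
  pigeonhole₃ P-unique Q-unique (inj₂ qx) (inj₂ qy) _         = inj₁ (Q-unique qx qy)
  pigeonhole₃ P-unique Q-unique (inj₁ px) (inj₂ _)  (inj₁ pz) = inj₂ (inj₁ (P-unique px pz))
  pigeonhole₃ P-unique Q-unique (inj₁ _)  (inj₂ qy) (inj₂ qz) = inj₂ (inj₂ (Q-unique qy qz))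
  pigeonhole₃ P-unique Q-unique (inj₂ _)  (inj₁ py) (inj₁ pz) = inj₂ (inj₂ (P-unique py pz))
  pigeonhole₃ P-unique Q-unique (inj₂ qx) (inj₁ _)  (inj₂ qz) = inj₂ (inj₁ (Q-unique qx qz))

  length≤2 : Unique xs → (∀ {x y z} → x ∈ xs → y ∈ xs → z ∈ xs → TwoEqual x y z) → length xs ≤ 2
  length≤2 {xs = []}              _ _ = z≤n
  length≤2 {xs = _ ∷ []}          _ _ = s≤s z≤n
  length≤2 {xs = _ ∷ _ ∷ []}      _ _ = s≤s (s≤s z≤n)
  length≤2 {xs = _ ∷ _ ∷ _ ∷ _} (x∉ ∷ y∉ ∷ _) three
    with three (here refl) (there (here refl)) (there (there (here refl)))
  ... | inj₁ x≡y        = ⊥-elim (All.head x∉ x≡y)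
  ... | inj₂ (inj₁ x≡z) = ⊥-elim (All.head (All.tail x∉) x≡z)
  ... | inj₂ (inj₂ y≡z) = ⊥-elim (All.head y∉ y≡z)

  length-concat-replicate : ∀ k (xs : List A) → length (concat (replicate k xs)) ≡ k * length xs
  length-concat-replicate zero    xs = refl
  length-concat-replicate (suc k) xs =
    trans (length-++ xs) (cong (length xs +_) (length-concat-replicate k xs))

  -- Defs.OnAtLeast k L i j is Occurrences (λ ℓ → PtOn R a b ℓ i j) k L by definition.
  Occurrences : (A → Set) → ℕ → List A → Set
  Occurrences P k xs =
    Σ (Fin k → Fin (length xs)) λ f → Injective _≡_ _≡_ f × (∀ t → P (lookup xs (f t)))

  module _ {P : A → Set} (P? : Decidable P) where

    count : List A → ℕ
    count xs = length (filter P? xs)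

    count-++ : ∀ xs ys → count (xs ++ ys) ≡ count xs + count ys
    count-++ xs ys = trans (cong length (filter-++ P? xs ys)) (length-++ (filter P? xs))

    count-concat-replicate : ∀ k xs → count (concat (replicate k xs)) ≡ k * count xs
    count-concat-replicate zero    xs = refl
    count-concat-replicate (suc k) xs =
      trans (count-++ xs _) (cong (count xs +_) (count-concat-replicate k xs))

    ∈⇒1≤count : x ∈ xs → P x → 1 ≤ count xs
    ∈⇒1≤count x∈xs px = filter-some P? (lose x∈xs px)

    count≤2 : Unique xs →
      (∀ {x y z} → x ∈ xs → y ∈ xs → z ∈ xs → P x → P y → P z → TwoEqual x y z) →
      count xs ≤ 2
    count≤2 xs-unique three = length≤2 (Unique.filter⁺ P? xs-unique) λ x∈ y∈ z∈ →
      let (x∈xs , px) = ∈-filter⁻ P? x∈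
          (y∈xs , py) = ∈-filter⁻ P? y∈
          (z∈xs , pz) = ∈-filter⁻ P? z∈
      in three x∈xs y∈xs z∈xs px py pz

    private
      occurrences-restrict : ∀ {j} xs (g : Fin j → Fin k) → Injective _≡_ _≡_ g →
        Occurrences P k xs → Occurrences P j xs
      occurrences-restrict xs g g-inj (f , f-inj , on) = f ∘ g , g-inj ∘ f-inj , on ∘ g

      occurrences-skip : ∀ x xs → Occurrences P k xs → Occurrences P k (x ∷ xs)
      occurrences-skip x xs (f , f-inj , on) = suc ∘ f , f-inj ∘ Fin.suc-injective , on

      occurrences-take-head : ∀ x xs → P x → Occurrences P k xs → Occurrences P (suc k) (x ∷ xs)
      occurrences-take-head {k = k} x xs px (f , f-inj , on) = f′ , f′-inj , on′
        where
          f′ : Fin (suc k) → Fin (length (x ∷ xs))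
          f′ zero    = zero
          f′ (suc t) = suc (f t)
          f′-inj : Injective _≡_ _≡_ f′
          f′-inj {zero}  {zero}  _  = refl
          f′-inj {zero}  {suc _} ()
          f′-inj {suc _} {zero}  ()
          f′-inj {suc s} {suc t} eq = cong suc (f-inj (Fin.suc-injective eq))
          on′ : ∀ t → P (lookup (x ∷ xs) (f′ t))
          on′ zero    = px
          on′ (suc t) = on t

      occurrences-avoiding-head : ∀ x xs (occ : Occurrences P k (x ∷ xs)) → (∀ t → zero ≢ proj₁ occ t) →
        Occurrences P k xs
      occurrences-avoiding-head {k = k} x xs (f , f-inj , on) f≢0 =
        f′ , (λ eq → f-inj (Fin.punchOut-injective (f≢0 _) (f≢0 _) eq)) , on′
        where
          f′ : Fin k → Fin (length xs)
          f′ t = punchOut (f≢0 t)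
          on′ : ∀ t → P (lookup xs (f′ t))
          on′ t = subst (P ∘ lookup (x ∷ xs)) (sym (Fin.punchIn-punchOut (f≢0 t))) (on t)

      occurrences-drop-one : ∀ x xs → Occurrences P (suc k) (x ∷ xs) → Occurrences P k xs
      occurrences-drop-one {k = k} x xs occ@(f , f-inj , _) =
        let (t₀ , t₀-removed) = head-preimage in
        occurrences-avoiding-head x xs
          (occurrences-restrict (x ∷ xs) (punchIn t₀) (Fin.punchIn-injective t₀ _ _) occ) t₀-removed
        where
          -- t₀ is the position sent to the head, or any position if there is none
          head-preimage : Σ (Fin (suc k)) λ t₀ → ∀ u → zero ≢ f (punchIn t₀ u)
          head-preimage with Fin.any? (λ t → f t Fin.≟ zero)
          ... | yes (t₀ , ft₀≡0) = t₀ , λ u 0≡f → Fin.punchInᵢ≢i t₀ u (f-inj (trans (sym 0≡f) (sym ft₀≡0)))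
          ... | no ∄t            = zero , λ u 0≡f → ∄t (suc u , sym 0≡f)

    occurrences⇒≤count : ∀ xs → Occurrences P k xs → k ≤ count xs
    occurrences⇒≤count [] (_ , f-inj , _) = Fin.injective⇒≤ f-inj
    occurrences⇒≤count {k = zero}  (x ∷ xs) _ = z≤n
    occurrences⇒≤count {k = suc k} (x ∷ xs) occ@(f , _ , on) with P? x
    ... | yes _  = s≤s (occurrences⇒≤count xs (occurrences-drop-one x xs occ))
    ... | no ¬px = occurrences⇒≤count xs
                     (occurrences-avoiding-head x xs occ λ t 0≡f → ¬px (subst (P ∘ lookup (x ∷ xs)) (sym 0≡f) (on t)))

    ≤count⇒occurrences : ∀ xs → k ≤ count xs → Occurrences P k xs
    ≤count⇒occurrences {k = zero}  xs       _ = (λ ()) , (λ { {()} }) , (λ ())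
    ≤count⇒occurrences {k = suc k} []       ()
    ≤count⇒occurrences {k = suc k} (x ∷ xs) k<c with P? x
    ... | yes px = occurrences-take-head x xs px (≤count⇒occurrences xs (s≤s⁻¹ k<c))
    ... | no _   = occurrences-skip x xs (≤count⇒occurrences xs k<c)

  module _ {_∼_ : A → B → Set} (_∼?_ : ∀ x y → Dec (x ∼ y)) where

    incidences : List A → List B → ℕ
    incidences xs ys = sum (map (λ x → count (x ∼?_) ys) xs)

    incidences-∷ʳ : ∀ xs y ys → incidences xs (y ∷ ys) ≡ count (_∼? y) xs + incidences xs ys
    private
      rearrange : ∀ x xs y ys → let c = count (x ∼?_) ys in
        c + incidences xs (y ∷ ys) ≡ count (_∼? y) xs + (c + incidences xs ys)
      rearrange x xs y ys = trans (cong (count (x ∼?_) ys +_) (incidences-∷ʳ xs y ys))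
                                  (x∙yz≈y∙xz (count (x ∼?_) ys) (count (_∼? y) xs) (incidences xs ys))

    incidences-∷ʳ []       y ys = refl
    incidences-∷ʳ (x ∷ xs) y ys with x ∼? y
    ... | yes _ = cong suc (rearrange x xs y ys)
    ... | no _  = rearrange x xs y ys

    ≤incidences : ∀ xs ys → (∀ {x} → x ∈ xs → k ≤ count (x ∼?_) ys) → length xs * k ≤ incidences xs ys
    ≤incidences []       ys _      = z≤n
    ≤incidences (x ∷ xs) ys k≤deg = ℕ.+-mono-≤ (k≤deg (here refl)) (≤incidences xs ys (k≤deg ∘ there))

    incidences≤ : ∀ {c} xs ys → (∀ {y} → y ∈ ys → count (_∼? y) xs ≤ c) → incidences xs ys ≤ length ys * c
    incidences≤ xs []       _      = ℕ.≤-reflexive (incidences-[] xs)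
      where
        incidences-[] : ∀ xs → incidences xs [] ≡ 0
        incidences-[] []       = refl
        incidences-[] (_ ∷ xs) = incidences-[] xs
    incidences≤ {c} xs (y ∷ ys) deg≤c = begin
      incidences xs (y ∷ ys)             ≡⟨ incidences-∷ʳ xs y ys ⟩
      count (_∼? y) xs + incidences xs ys ≤⟨ ℕ.+-mono-≤ (deg≤c (here refl)) (incidences≤ xs ys (deg≤c ∘ there)) ⟩
      suc (length ys) * c                 ∎
      where open ℕ.≤-Reasoning

    double-counting : ∀ {c} xs ys → (∀ {x} → x ∈ xs → k ≤ count (x ∼?_) ys) →
      (∀ {y} → y ∈ ys → count (_∼? y) xs ≤ c) → length xs * k ≤ length ys * c
    double-counting xs ys k≤deg deg≤c = ℕ.≤-trans (≤incidences xs ys k≤deg) (incidences≤ xs ys deg≤c)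

open ListCounting

module HalfGridIndices where
  open import Data.Nat using (_+_; _*_; _∸_; _≤_; _<_)

  private
    variable
      m : ℕ

  -- Grid indices range over Fin (suc m), so m = n − 1 and the hypotenuse is i + j = m.
  OnBoundary : Fin (suc m) → Fin (suc m) → Set
  OnBoundary {m} i j = toℕ i ≡ 0 ⊎ toℕ j ≡ 0 ⊎ toℕ i + toℕ j ≡ m

  RimPoint : Fin (suc m) × Fin (suc m) → Set
  RimPoint {m} (i , j) = toℕ i + toℕ j < suc m × ¬ (toℕ i ≡ 0 × toℕ j ≡ 0) × OnBoundary i j

  module _ {m : ℕ} where

    private
      toℕ≡0-unique : {i j : Fin (suc m)} → toℕ i ≡ 0 → toℕ j ≡ 0 → i ≡ j
      toℕ≡0-unique i≡0 j≡0 = Fin.toℕ-injective (trans i≡0 (sym j≡0))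

    boundary-column : ∀ {i j₁ j₂ j₃ : Fin (suc m)} → toℕ i ≢ 0 →
      OnBoundary i j₁ → OnBoundary i j₂ → OnBoundary i j₃ → TwoEqual j₁ j₂ j₃
    boundary-column {i} i≢0 b₁ b₂ b₃ =
      pigeonhole₃ toℕ≡0-unique sum-unique (column b₁) (column b₂) (column b₃)
      where
        column : ∀ {j} → OnBoundary i j → toℕ j ≡ 0 ⊎ toℕ i + toℕ j ≡ m
        column (inj₁ i≡0) = ⊥-elim (i≢0 i≡0)
        column (inj₂ b)   = b
        sum-unique : ∀ {j j′} → toℕ i + toℕ j ≡ m → toℕ i + toℕ j′ ≡ m → j ≡ j′
        sum-unique e e′ = Fin.toℕ-injective (ℕ.+-cancelˡ-≡ (toℕ i) _ _ (trans e (sym e′)))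

    boundary-row : ∀ {j i₁ i₂ i₃ : Fin (suc m)} → toℕ j ≢ 0 →
      OnBoundary i₁ j → OnBoundary i₂ j → OnBoundary i₃ j → TwoEqual i₁ i₂ i₃
    boundary-row {j} j≢0 b₁ b₂ b₃ =
      pigeonhole₃ toℕ≡0-unique sum-unique (row b₁) (row b₂) (row b₃)
      where
        row : ∀ {i} → OnBoundary i j → toℕ i ≡ 0 ⊎ toℕ i + toℕ j ≡ m
        row (inj₁ i≡0)        = inj₁ i≡0
        row (inj₂ (inj₁ j≡0)) = ⊥-elim (j≢0 j≡0)
        row (inj₂ (inj₂ s))   = inj₂ s
        sum-unique : ∀ {i i′} → toℕ i + toℕ j ≡ m → toℕ i′ + toℕ j ≡ m → i ≡ i′
        sum-unique e e′ = Fin.toℕ-injective (ℕ.+-cancelʳ-≡ (toℕ j) _ _ (trans e (sym e′)))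

  inHalf-bottom : (r : Fin m) → toℕ (suc r) + toℕ (zero {m}) < suc m
  inHalf-bottom {m} r = subst (_< suc m) (sym (ℕ.+-identityʳ _)) (s≤s (Fin.toℕ<n r))

  inHalf-left : (r : Fin m) → toℕ (zero {m}) + toℕ (suc r) < suc m
  inHalf-left r = s≤s (Fin.toℕ<n r)

  bottomEdge leftEdge : Fin (suc m) → Fin (suc (suc m)) × Fin (suc (suc m))
  bottomEdge r = suc r , zero
  leftEdge   r = zero , suc r

  -- hypotenuse r is the point (1 + r, m − r).
  hypotenuse : Fin m → Fin (suc (suc m)) × Fin (suc (suc m))
  hypotenuse r = suc (inject₁ r) , inject₁ (suc (opposite r))

  rim : ∀ m → List (Fin (suc m) × Fin (suc m))
  rim zero    = []
  rim (suc m) = tabulate bottomEdge ++ tabulate leftEdge ++ tabulate hypotenuse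

  toℕ-hypotenuse : (r : Fin m) → toℕ (proj₁ (hypotenuse r)) + toℕ (proj₂ (hypotenuse r)) ≡ suc m
  toℕ-hypotenuse {m} r = begin
    toℕ (suc (inject₁ r)) + toℕ (inject₁ (suc (opposite r)))
      ≡⟨ cong₂ _+_ (cong suc (Fin.toℕ-inject₁ r)) (Fin.toℕ-inject₁ (suc (opposite r))) ⟩
    suc (toℕ r) + suc (toℕ (opposite r))    ≡⟨ cong (λ o → suc (toℕ r) + suc o) (Fin.opposite-prop r) ⟩
    suc (toℕ r) + suc (m ∸ suc (toℕ r))     ≡⟨ ℕ.+-suc (suc (toℕ r)) _ ⟩
    suc (suc (toℕ r) + (m ∸ suc (toℕ r)))   ≡⟨ cong suc (ℕ.m+[n∸m]≡n (Fin.toℕ<n r)) ⟩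
    suc m                                   ∎
    where open ≡-Reasoning

  rim-RimPoint : ∀ m → All RimPoint (rim m)
  rim-RimPoint zero    = []
  rim-RimPoint (suc m) =
    All.++⁺ (All.tabulate⁺ bottom) (All.++⁺ (All.tabulate⁺ left) (All.tabulate⁺ hyp))
    where
      bottom : ∀ r → RimPoint (bottomEdge r)
      bottom r = inHalf-bottom r , (λ ()) , inj₂ (inj₁ refl)
      left : ∀ r → RimPoint (leftEdge r)
      left r = inHalf-left r , (λ ()) , inj₁ refl
      hyp : ∀ r → RimPoint (hypotenuse r)
      hyp r = subst (_< suc (suc m)) (sym (toℕ-hypotenuse r)) ℕ.≤-refl
            , (λ ()) , inj₂ (inj₂ (toℕ-hypotenuse r))

  rim-unique : ∀ m → Unique (rim m)
  rim-unique zero    = []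
  rim-unique (suc m) =
    Unique.++⁺ (Unique.tabulate⁺ {f = bottomEdge} (Fin.suc-injective ∘ cong proj₁))
      (Unique.++⁺ (Unique.tabulate⁺ {f = leftEdge} (Fin.suc-injective ∘ cong proj₂))
                  (Unique.tabulate⁺ {f = hypotenuse} (Fin.inject₁-injective ∘ Fin.suc-injective ∘ cong proj₁))
                  left∩hyp=∅)
      bottom∩rest=∅
    where
      left∩hyp=∅ : ∀ {p} → ¬ (p ∈ tabulate leftEdge × p ∈ tabulate hypotenuse)
      left∩hyp=∅ (p∈l , p∈h) with ∈-tabulate⁻ {f = leftEdge} p∈l | ∈-tabulate⁻ {f = hypotenuse} p∈h
      ... | _ , refl | _ , ()
      bottom∩rest=∅ : ∀ {p} → ¬ (p ∈ tabulate bottomEdge × p ∈ tabulate leftEdge ++ tabulate hypotenuse)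
      bottom∩rest=∅ (p∈b , p∈r) with ∈-tabulate⁻ {f = bottomEdge} p∈b | ∈-++⁻ (tabulate leftEdge) p∈r
      ... | _ , refl | inj₁ p∈l with ∈-tabulate⁻ {f = leftEdge} p∈l
      ...   | _ , ()
      bottom∩rest=∅ (p∈b , p∈r) | _ , refl | inj₂ p∈h with ∈-tabulate⁻ {f = hypotenuse} p∈h
      ...   | _ , ()

  length-rim : ∀ m → length (rim (suc m)) ≡ suc m + (suc m + m)
  length-rim m = begin
    length (bottom ++ left ++ hyp)             ≡⟨ length-++ bottom ⟩
    length bottom + length (left ++ hyp)       ≡⟨ cong (length bottom +_) (length-++ left) ⟩
    length bottom + (length left + length hyp) ≡⟨ cong₂ _+_ (length-tabulate bottomEdge)
                                                    (cong₂ _+_ (length-tabulate leftEdge) (length-tabulate (hypotenuse {m}))) ⟩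
    suc m + (suc m + m)                        ∎
    where
      open ≡-Reasoning
      bottom left hyp : List (Fin (suc (suc m)) × Fin (suc (suc m)))
      bottom = tabulate (bottomEdge {m})
      left   = tabulate (leftEdge {m})
      hyp    = tabulate (hypotenuse {m})

  3m≤1+length-rim : ∀ m → 3 * m ≤ suc (length (rim m))
  3m≤1+length-rim zero    = z≤n
  3m≤1+length-rim (suc m) = ℕ.≤-reflexive (trans (arithmetic m) (cong suc (sym (length-rim m))))
    where
      arithmetic : ∀ m → 3 * suc m ≡ suc (suc m + (suc m + m))
      arithmetic = solve-∀

  m≤⌈m/2⌉+⌈m/2⌉ : ∀ m → m ≤ ⌈ m /2⌉ + ⌈ m /2⌉
  m≤⌈m/2⌉+⌈m/2⌉ m = begin
    m                     ≡⟨ ℕ.⌊n/2⌋+⌈n/2⌉≡n m ⟨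
    ⌊ m /2⌋ + ⌈ m /2⌉     ≤⟨ ℕ.+-monoˡ-≤ ⌈ m /2⌉ (ℕ.⌊n/2⌋≤⌈n/2⌉ m) ⟩
    ⌈ m /2⌉ + ⌈ m /2⌉     ∎
    where open ℕ.≤-Reasoning

  ⌈m/2⌉+⌈m/2⌉≤1+m : ∀ m → ⌈ m /2⌉ + ⌈ m /2⌉ ≤ suc m
  ⌈m/2⌉+⌈m/2⌉≤1+m m = begin
    ⌊ suc m /2⌋ + ⌊ suc m /2⌋ ≤⟨ ℕ.+-monoʳ-≤ ⌊ suc m /2⌋ (ℕ.⌊n/2⌋≤⌈n/2⌉ (suc m)) ⟩
    ⌊ suc m /2⌋ + ⌈ suc m /2⌉ ≡⟨ ℕ.⌊n/2⌋+⌈n/2⌉≡n (suc m) ⟩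
    suc m                     ∎
    where open ℕ.≤-Reasoning

  lowerHalf : ∀ m → List (Fin m)
  lowerHalf m = tabulate (λ s → inject≤ s (ℕ.⌈n/2⌉≤n m))

  length-lowerHalf : ∀ m → length (lowerHalf m) ≡ ⌈ m /2⌉
  length-lowerHalf m = length-tabulate _

  ∈-lowerHalf : {r : Fin m} → toℕ r < ⌈ m /2⌉ → r ∈ lowerHalf m
  ∈-lowerHalf {m} {r} r<q = subst (_∈ lowerHalf m) inject≤-fromℕ< (∈-tabulate⁺ (fromℕ< r<q))
    where
      inject≤-fromℕ< : inject≤ (fromℕ< r<q) (ℕ.⌈n/2⌉≤n m) ≡ r
      inject≤-fromℕ< = Fin.toℕ-injective (trans (Fin.toℕ-inject≤ _ _) (Fin.toℕ-fromℕ< r<q))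

  opposite∈lowerHalf : {r : Fin m} → ⌈ m /2⌉ ≤ toℕ r → opposite r ∈ lowerHalf m
  opposite∈lowerHalf {m} {r} q≤r = ∈-lowerHalf (subst (_< ⌈ m /2⌉) (sym (Fin.opposite-prop r)) m∸r′<q)
    where
      q : ℕ
      q = ⌈ m /2⌉
      m∸r′<q : m ∸ suc (toℕ r) < q
      m∸r′<q = ℕ.+-cancelˡ-≤ (toℕ r) _ _ (begin
        toℕ r + suc (m ∸ suc (toℕ r)) ≡⟨ ℕ.+-suc (toℕ r) _ ⟩
        suc (toℕ r) + (m ∸ suc (toℕ r)) ≡⟨ ℕ.m+[n∸m]≡n (Fin.toℕ<n r) ⟩
        m                               ≤⟨ m≤⌈m/2⌉+⌈m/2⌉ m ⟩
        q + q                           ≤⟨ ℕ.+-monoˡ-≤ q q≤r ⟩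
        toℕ r + q                       ∎)
        where open ℕ.≤-Reasoning

  upperHalf-pair-notInHalf : {i j : Fin m} → ⌈ m /2⌉ ≤ toℕ i → ⌈ m /2⌉ ≤ toℕ j →
    ¬ (toℕ (suc i) + toℕ (suc j) < suc m)
  upperHalf-pair-notInHalf {m} {i} {j} q≤i q≤j i+j<n = ℕ.<-irrefl refl (begin-strict
    m                     ≤⟨ m≤⌈m/2⌉+⌈m/2⌉ m ⟩
    ⌈ m /2⌉ + ⌈ m /2⌉     ≤⟨ ℕ.+-mono-≤ q≤i q≤j ⟩
    toℕ i + toℕ j         ≤⟨ ℕ.+-monoʳ-≤ (toℕ i) (ℕ.n≤1+n (toℕ j)) ⟩
    toℕ i + suc (toℕ j)   <⟨ s≤s⁻¹ i+j<n ⟩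
    m                     ∎)
    where open ℕ.≤-Reasoning

open HalfGridIndices

module RealFieldProperties (R : RealField) where
  open RealField R

  commutativeRing : CommutativeRing 0ℓ 0ℓ
  commutativeRing = record
    { Carrier = Carrier ; _≈_ = _≡_ ; _+_ = _+_ ; _*_ = _*_ ; -_ = -_ ; 0# = 0# ; 1# = 1#
    ; isCommutativeRing = record
      { isRing = record
        { +-isAbelianGroup = record
          { isGroup = record
            { isMonoid = record
              { isSemigroup = record
                { isMagma = record { isEquivalence = isEquivalence ; ∙-cong = cong₂ _+_ }
                ; assoc   = +-assoc
                }
              ; identity = comm∧idˡ⇒id +-comm +-identityˡ
              }
            ; inverse = comm∧invˡ⇒inv +-comm -‿inverseˡ
            ; ⁻¹-cong = cong -_
            }
          ; comm = +-comm
          }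
        ; *-cong     = cong₂ _*_
        ; *-assoc    = *-assoc
        ; *-identity = comm∧idˡ⇒id *-comm *-identityˡ
        ; distrib    = comm∧distrˡ⇒distr (cong₂ _+_) *-comm distribˡ
        }
      ; *-comm = *-comm
      }
    }

  open CommutativeRing commutativeRing public using (+-identityʳ; zeroˡ)
  open import Algebra.Properties.Ring (CommutativeRing.ring commutativeRing) public
    using (x∙y⁻¹≈ε⇒x≈y)

  infix 4 _≟_
  _≟_ : DecidableEquality Carrier
  x ≟ y with <-trichotomy x y
  ... | inj₁ x<y        = no λ { refl → <-irrefl x x<y }
  ... | inj₂ (inj₁ x≡y) = yes x≡y
  ... | inj₂ (inj₂ y<x) = no λ { refl → <-irrefl x y<x }

  *-cancelˡ-≡ : ∀ c {x y} → c ≢ 0# → c * x ≡ c * y → x ≡ y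
  *-cancelˡ-≡ c {x} {y} c≢0 cx≡cy = begin
    x                ≡⟨ *-identityˡ x ⟨
    1# * x           ≡⟨ cong (_* x) c⁻¹c≡1 ⟨
    (c⁻¹ * c) * x    ≡⟨ *-assoc c⁻¹ c x ⟩
    c⁻¹ * (c * x)    ≡⟨ cong (c⁻¹ *_) cx≡cy ⟩
    c⁻¹ * (c * y)    ≡⟨ *-assoc c⁻¹ c y ⟨
    (c⁻¹ * c) * y    ≡⟨ cong (_* y) c⁻¹c≡1 ⟩
    1# * y           ≡⟨ *-identityˡ y ⟩
    y                ∎
    where
      open ≡-Reasoning
      c⁻¹ : Carrier
      c⁻¹ = proj₁ (inverse c c≢0)
      c⁻¹c≡1 : c⁻¹ * c ≡ 1#
      c⁻¹c≡1 = trans (*-comm c⁻¹ c) (proj₂ (inverse c c≢0))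

  x+0*y≡x : ∀ x y → x + 0# * y ≡ x
  x+0*y≡x x y = trans (cong (x +_) (zeroˡ y)) (+-identityʳ x)

  0*x+y≡y : ∀ x y → 0# * x + y ≡ y
  0*x+y≡y x y = trans (cong (_+ y) (zeroˡ x)) (+-identityˡ y)

  x-y+y≡x : ∀ x y → (x + - y) + y ≡ x
  x-y+y≡x x y = trans (+-assoc x (- y) y) (trans (cong (x +_) (-‿inverseˡ y)) (+-identityʳ x))

  crossed-sum : ∀ d e u v → d * u + e * (d + v) ≡ d * (e + u) + e * v
  crossed-sum d e u v = begin
    d * u + e * (d + v)       ≡⟨ cong (d * u +_) (distribˡ e d v) ⟩
    d * u + (e * d + e * v)   ≡⟨ +-assoc (d * u) (e * d) (e * v) ⟨
    (d * u + e * d) + e * v   ≡⟨ cong (_+ e * v) (+-comm (d * u) (e * d)) ⟩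
    (e * d + d * u) + e * v   ≡⟨ cong (λ ed → (ed + d * u) + e * v) (*-comm e d) ⟩
    (d * e + d * u) + e * v   ≡⟨ cong (_+ e * v) (distribˡ d e u) ⟨
    d * (e + u) + e * v       ∎
    where open ≡-Reasoning

  strictlyIncreasing⇒injective : ∀ {n} {f : Fin n → Carrier} → StrictlyIncreasing R f → Injective _≡_ _≡_ f
  strictlyIncreasing⇒injective {f = f} f-inc {i} {j} fi≡fj with ℕ.<-cmp (toℕ i) (toℕ j)
  ... | tri< i<j _ _ = ⊥-elim (<-irrefl (f j) (subst (_< f j) fi≡fj (f-inc i j i<j)))
  ... | tri≈ _ i≡j _ = Fin.toℕ-injective i≡j
  ... | tri> _ _ j<i = ⊥-elim (<-irrefl (f i) (subst (_< f i) (sym fi≡fj) (f-inc j i j<i)))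

module HalfGrid (R : RealField) {m : ℕ} (a b : Fin (suc m) → RealField.Carrier R)
                (a-inc : StrictlyIncreasing R a) (b-inc : StrictlyIncreasing R b) where
  open RealField R
  open RealFieldProperties R

  Incident : Fin (suc m) × Fin (suc m) → Line R → Set
  Incident (i , j) ℓ = PtOn R a b ℓ i j

  incident? : ∀ p ℓ → Dec (Incident p ℓ)
  incident? (i , j) ℓ = α ℓ * a i + β ℓ * b j ≟ γ ℓ

  a-injective : Injective _≡_ _≡_ a
  a-injective = strictlyIncreasing⇒injective a-inc

  b-injective : Injective _≡_ _≡_ b
  b-injective = strictlyIncreasing⇒injective b-inc

  module _ (ℓ : Line R) where

    vertical-lhs : β ℓ ≡ 0# → ∀ x y → α ℓ * x + β ℓ * y ≡ α ℓ * x
    vertical-lhs β≡0 x y = trans (cong (λ c → α ℓ * x + c * y) β≡0) (x+0*y≡x _ y)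

    horizontal-lhs : α ℓ ≡ 0# → ∀ x y → α ℓ * x + β ℓ * y ≡ β ℓ * y
    horizontal-lhs α≡0 x y = trans (cong (λ c → c * x + β ℓ * y) α≡0) (0*x+y≡y x _)

    vertical⇒sameColumn : β ℓ ≡ 0# → ∀ {i j i′ j′} → PtOn R a b ℓ i j → PtOn R a b ℓ i′ j′ → i ≡ i′
    vertical⇒sameColumn β≡0 {i} {j} {i′} {j′} on on′ =
      a-injective (*-cancelˡ-≡ (α ℓ) (λ α≡0 → nondeg ℓ (α≡0 , β≡0)) (begin
        α ℓ * a i                  ≡⟨ vertical-lhs β≡0 (a i) (b j) ⟨
        α ℓ * a i + β ℓ * b j      ≡⟨ trans on (sym on′) ⟩
        α ℓ * a i′ + β ℓ * b j′    ≡⟨ vertical-lhs β≡0 (a i′) (b j′) ⟩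
        α ℓ * a i′                 ∎))
      where open ≡-Reasoning

    horizontal⇒sameRow : α ℓ ≡ 0# → ∀ {i j i′ j′} → PtOn R a b ℓ i j → PtOn R a b ℓ i′ j′ → j ≡ j′
    horizontal⇒sameRow α≡0 {i} {j} {i′} {j′} on on′ =
      b-injective (*-cancelˡ-≡ (β ℓ) (λ β≡0 → nondeg ℓ (α≡0 , β≡0)) (begin
        β ℓ * b j                  ≡⟨ horizontal-lhs α≡0 (a i) (b j) ⟨
        α ℓ * a i + β ℓ * b j      ≡⟨ trans on (sym on′) ⟩
        α ℓ * a i′ + β ℓ * b j′    ≡⟨ horizontal-lhs α≡0 (a i′) (b j′) ⟩
        β ℓ * b j′                 ∎))
      where open ≡-Reasoning

    vertical⇒fullColumn : β ℓ ≡ 0# → ∀ {i j j′} → PtOn R a b ℓ i j → PtOn R a b ℓ i j′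
    vertical⇒fullColumn β≡0 {i} {j} {j′} on =
      trans (vertical-lhs β≡0 (a i) (b j′)) (trans (sym (vertical-lhs β≡0 (a i) (b j))) on)

    horizontal⇒fullRow : α ℓ ≡ 0# → ∀ {i j i′} → PtOn R a b ℓ i j → PtOn R a b ℓ i′ j
    horizontal⇒fullRow α≡0 {i} {j} {i′} on =
      trans (horizontal-lhs α≡0 (a i′) (b j)) (trans (sym (horizontal-lhs α≡0 (a i) (b j))) on)

  collinear-rimPoints⇒TwoEqual : Generic R a b → ∀ ℓ → ¬ ThroughVertex R a b ℓ →
    ∀ {p q r} → RimPoint p → RimPoint q → RimPoint r →
    Incident p ℓ → Incident q ℓ → Incident r ℓ → TwoEqual p q r
  collinear-rimPoints⇒TwoEqual generic ℓ ℓ∌V {i₁ , j₁} {i₂ , j₂} {i₃ , j₃} (h₁ , _ , b₁) (h₂ , _ , b₂) (h₃ , _ , b₃) o₁ o₂ o₃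
    with α ℓ ≟ 0# | β ℓ ≟ 0#
  ... | yes α≡0 | yes β≡0 = ⊥-elim (nondeg ℓ (α≡0 , β≡0))
  ... | no α≢0  | no β≢0  = generic ℓ α≢0 β≢0 i₁ j₁ i₂ j₂ i₃ j₃ h₁ h₂ h₃ o₁ o₂ o₃
  ... | no _    | yes β≡0
    with refl ← vertical⇒sameColumn ℓ β≡0 o₁ o₂ | refl ← vertical⇒sameColumn ℓ β≡0 o₁ o₃ =
      TwoEqual-map (i₁ ,_) (boundary-column i₁≢0 b₁ b₂ b₃)
    where
      i₁≢0 : toℕ i₁ ≢ 0
      i₁≢0 i₁≡0 = ℓ∌V (i₁ , zero , i₁≡0 , refl , vertical⇒fullColumn ℓ β≡0 o₁)
  ... | yes α≡0 | no _
    with refl ← horizontal⇒sameRow ℓ α≡0 o₁ o₂ | refl ← horizontal⇒sameRow ℓ α≡0 o₁ o₃ =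
      TwoEqual-map (_, j₁) (boundary-row j₁≢0 b₁ b₂ b₃)
    where
      j₁≢0 : toℕ j₁ ≢ 0
      j₁≢0 j₁≡0 = ℓ∌V (zero , j₁ , refl , j₁≡0 , horizontal⇒fullRow ℓ α≡0 o₁)

  -- The lines of the cover are indexed by r : Fin m, standing for the nonzero grid index 1 + r.
  vertical : Fin m → Line R
  vertical r = record { α = 1# ; β = 0# ; γ = a (suc r) ; nondeg = λ (1≡0 , _) → 0≢1 (sym 1≡0) }

  horizontal : Fin m → Line R
  horizontal r = record { α = 0# ; β = 1# ; γ = b (suc r) ; nondeg = λ (_ , 1≡0) → 0≢1 (sym 1≡0) }

  increment≢0 : ∀ {f : Fin (suc m) → Carrier} → Injective _≡_ _≡_ f → ∀ r → f (suc r) + - f zero ≢ 0#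
  increment≢0 f-inj r δ≡0 = Fin.0≢1+n (sym (f-inj (x∙y⁻¹≈ε⇒x≈y _ _ δ≡0)))

  -- The line through (a (1 + r), b 0) and (a 0, b (1 + r)).
  antidiagonal : Fin m → Line R
  antidiagonal r = record
    { α = d ; β = e ; γ = d * a (suc r) + e * b zero
    ; nondeg = λ (d≡0 , _) → increment≢0 b-injective r d≡0
    }
    where
      d e : Carrier
      d = b (suc r) + - b zero
      e = a (suc r) + - a zero

  vertical-incident : ∀ r j → PtOn R a b (vertical r) (suc r) j
  vertical-incident r j = trans (x+0*y≡x _ (b j)) (*-identityˡ (a (suc r)))

  horizontal-incident : ∀ r i → PtOn R a b (horizontal r) i (suc r)
  horizontal-incident r i = trans (0*x+y≡y (a i) _) (*-identityˡ (b (suc r)))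

  antidiagonal-incident-bottom : ∀ r → PtOn R a b (antidiagonal r) (suc r) zero
  antidiagonal-incident-bottom r = refl

  antidiagonal-incident-left : ∀ r → PtOn R a b (antidiagonal r) zero (suc r)
  antidiagonal-incident-left r = begin
    d * a zero + e * b (suc r)          ≡⟨ cong (λ y → d * a zero + e * y) (x-y+y≡x (b (suc r)) (b zero)) ⟨
    d * a zero + e * (d + b zero)       ≡⟨ crossed-sum d e (a zero) (b zero) ⟩
    d * (e + a zero) + e * b zero       ≡⟨ cong (λ x → d * x + e * b zero) (x-y+y≡x (a (suc r)) (a zero)) ⟩
    d * a (suc r) + e * b zero          ∎
    where
      open ≡-Reasoning
      d e : Carrier
      d = α (antidiagonal r)
      e = β (antidiagonal r)

  vertical-avoidsVertex : ∀ r → ¬ ThroughVertex R a b (vertical r)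
  vertical-avoidsVertex r (i , _ , i≡0 , _ , on) =
    ℕ.1+n≢0 (trans (cong toℕ (vertical⇒sameColumn (vertical r) refl (vertical-incident r zero) on)) i≡0)

  horizontal-avoidsVertex : ∀ r → ¬ ThroughVertex R a b (horizontal r)
  horizontal-avoidsVertex r (_ , j , _ , j≡0 , on) =
    ℕ.1+n≢0 (trans (cong toℕ (horizontal⇒sameRow (horizontal r) refl (horizontal-incident r zero) on)) j≡0)

  antidiagonal-avoidsVertex : Generic R a b → ∀ r → ¬ ThroughVertex R a b (antidiagonal r)
  antidiagonal-avoidsVertex generic r (i , j , i≡0 , j≡0 , on)
    with refl ← Fin.toℕ-injective {i = i} {j = zero} i≡0 | refl ← Fin.toℕ-injective {i = j} {j = zero} j≡0
    with generic (antidiagonal r) (increment≢0 b-injective r) (increment≢0 a-injective r) (suc r) zero zero (suc r) zero zero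
           (inHalf-bottom r) (inHalf-left r) (s≤s z≤n)
           (antidiagonal-incident-bottom r) (antidiagonal-incident-left r) on
  ... | inj₁ ()
  ... | inj₂ (inj₁ ())
  ... | inj₂ (inj₂ ())

module Bounds (R : RealField) {m : ℕ} (a b : Fin (suc m) → RealField.Carrier R)
              (a-inc : StrictlyIncreasing R a) (b-inc : StrictlyIncreasing R b)
              (generic : Generic R a b) where
  open import Data.Nat using (_+_; _*_; _≤_; _<_)
  open HalfGrid R a b a-inc b-inc

  member-avoidsVertex : ∀ {L ℓ} → AvoidsVertex R a b L → ℓ ∈ L → ¬ ThroughVertex R a b ℓ
  member-avoidsVertex {L} avoids ℓ∈L = subst (¬_ ∘ ThroughVertex R a b) (sym (lookup-index ℓ∈L)) (avoids (index ℓ∈L))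

  rim-incidences : ∀ {k} L → AvoidsVertex R a b L → KCover R a b k L → length (rim m) * k ≤ length L * 2
  rim-incidences {k} L avoids cover = double-counting incident? (rim m) L lines-through-rim rim-on-line
    where
      lines-through-rim : ∀ {p} → p ∈ rim m → k ≤ count (incident? p) L
      lines-through-rim {i , j} p∈rim with All.lookup (rim-RimPoint m) p∈rim
      ... | inHalf , ≢V , _ = occurrences⇒≤count (incident? (i , j)) L (cover i j inHalf ≢V)
      rim-on-line : ∀ {ℓ} → ℓ ∈ L → count (λ p → incident? p ℓ) (rim m) ≤ 2
      rim-on-line {ℓ} ℓ∈L = count≤2 (λ p → incident? p ℓ) (rim-unique m) λ p∈ q∈ r∈ →
        collinear-rimPoints⇒TwoEqual generic ℓ (member-avoidsVertex avoids ℓ∈L)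
          (All.lookup (rim-RimPoint m) p∈) (All.lookup (rim-RimPoint m) q∈) (All.lookup (rim-RimPoint m) r∈)

  lowerBound : ∀ {k} L → AvoidsVertex R a b L → KCover R a b k L → 3 * suc m * k ≤ 2 * length L + 4 * k
  lowerBound {k} L avoids cover = begin
    3 * suc m * k                   ≡⟨ expand m k ⟩
    3 * m * k + 3 * k               ≤⟨ ℕ.+-monoˡ-≤ (3 * k) (ℕ.*-monoˡ-≤ k (3m≤1+length-rim m)) ⟩
    suc (length (rim m)) * k + 3 * k ≡⟨ regroup (length (rim m)) k ⟩
    length (rim m) * k + 4 * k      ≤⟨ ℕ.+-monoˡ-≤ (4 * k) (rim-incidences L avoids cover) ⟩
    length L * 2 + 4 * k            ≡⟨ cong (_+ 4 * k) (ℕ.*-comm (length L) 2) ⟩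
    2 * length L + 4 * k            ∎
    where
      open ℕ.≤-Reasoning
      expand : ∀ m k → 3 * suc m * k ≡ 3 * m * k + 3 * k
      expand = solve-∀
      regroup : ∀ l k → suc l * k + 3 * k ≡ l * k + 4 * k
      regroup = solve-∀

  verticals horizontals antidiagonals coverOnce : List (Line R)
  verticals     = map vertical (lowerHalf m)
  horizontals   = map horizontal (lowerHalf m)
  antidiagonals = map (antidiagonal ∘ opposite) (lowerHalf m)
  coverOnce     = verticals ++ horizontals ++ antidiagonals

  coverOnce-avoidsVertex : All (¬_ ∘ ThroughVertex R a b) coverOnce
  coverOnce-avoidsVertex =
    All.++⁺ (All.map⁺ {f = vertical} (All.universal vertical-avoidsVertex (lowerHalf m)))
      (All.++⁺ (All.map⁺ {f = horizontal} (All.universal horizontal-avoidsVertex (lowerHalf m)))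
               (All.map⁺ {f = antidiagonal ∘ opposite} (All.universal (antidiagonal-avoidsVertex generic ∘ opposite) (lowerHalf m))))

  length-coverOnce : length coverOnce ≡ ⌈ m /2⌉ + (⌈ m /2⌉ + ⌈ m /2⌉)
  length-coverOnce = begin
    length (verticals ++ horizontals ++ antidiagonals)
      ≡⟨ length-++ verticals ⟩
    length verticals + length (horizontals ++ antidiagonals)
      ≡⟨ cong (length verticals +_) (length-++ horizontals) ⟩
    length verticals + (length horizontals + length antidiagonals)
      ≡⟨ cong₂ _+_ (length-map vertical (lowerHalf m))
                   (cong₂ _+_ (length-map horizontal (lowerHalf m)) (length-map (antidiagonal ∘ opposite) (lowerHalf m))) ⟩
    length (lowerHalf m) + (length (lowerHalf m) + length (lowerHalf m))
      ≡⟨ cong (λ q → q + (q + q)) (length-lowerHalf m) ⟩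
    ⌈ m /2⌉ + (⌈ m /2⌉ + ⌈ m /2⌉) ∎
    where open ≡-Reasoning

  vertical∈ : ∀ {r} → toℕ r < ⌈ m /2⌉ → vertical r ∈ coverOnce
  vertical∈ r<q = ∈-++⁺ˡ (∈-map⁺ vertical (∈-lowerHalf r<q))

  horizontal∈ : ∀ {r} → toℕ r < ⌈ m /2⌉ → horizontal r ∈ coverOnce
  horizontal∈ r<q = ∈-++⁺ʳ verticals (∈-++⁺ˡ (∈-map⁺ horizontal (∈-lowerHalf r<q)))

  antidiagonal∈ : ∀ {r} → ⌈ m /2⌉ ≤ toℕ r → antidiagonal r ∈ coverOnce
  antidiagonal∈ {r} q≤r = ∈-++⁺ʳ verticals (∈-++⁺ʳ horizontals
    (subst (λ r′ → antidiagonal r′ ∈ antidiagonals) (Fin.opposite-involutive r)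
           (∈-map⁺ (antidiagonal ∘ opposite) (opposite∈lowerHalf q≤r))))

  covering-line : ∀ i j → toℕ i + toℕ j < suc m → ¬ (toℕ i ≡ 0 × toℕ j ≡ 0) →
    Σ (Line R) λ ℓ → ℓ ∈ coverOnce × PtOn R a b ℓ i j
  covering-line zero zero _ ≢V = ⊥-elim (≢V (refl , refl))
  covering-line zero (suc r) _ _ with toℕ r <? ⌈ m /2⌉
  ... | yes r<q = horizontal r , horizontal∈ r<q , horizontal-incident r zero
  ... | no r≮q  = antidiagonal r , antidiagonal∈ (ℕ.≮⇒≥ r≮q) , antidiagonal-incident-left r
  covering-line (suc r) j _ _ with toℕ r <? ⌈ m /2⌉
  ... | yes r<q = vertical r , vertical∈ r<q , vertical-incident r j
  covering-line (suc r) zero _ _ | no r≮q =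
    antidiagonal r , antidiagonal∈ (ℕ.≮⇒≥ r≮q) , antidiagonal-incident-bottom r
  covering-line (suc r) (suc s) inHalf _ | no r≮q with toℕ s <? ⌈ m /2⌉
  ... | yes s<q = horizontal s , horizontal∈ s<q , horizontal-incident s (suc r)
  ... | no s≮q  = ⊥-elim (upperHalf-pair-notInHalf (ℕ.≮⇒≥ r≮q) (ℕ.≮⇒≥ s≮q) inHalf)

  copies : ℕ → List (Line R)
  copies k = concat (replicate k coverOnce)

  copies-avoidVertex : ∀ k → AvoidsVertex R a b (copies k)
  copies-avoidVertex k t = All.lookup (All.concat⁺ (All.replicate⁺ k coverOnce-avoidsVertex)) (∈-lookup t)

  copies-kCover : ∀ k → KCover R a b k (copies k)
  copies-kCover k i j inHalf ≢V with covering-line i j inHalf ≢V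
  ... | ℓ , ℓ∈ , on = ≤count⇒occurrences (incident? (i , j)) (copies k) (begin
    k                                       ≡⟨ ℕ.*-identityʳ k ⟨
    k * 1                                   ≤⟨ ℕ.*-monoʳ-≤ k (∈⇒1≤count (incident? (i , j)) ℓ∈ on) ⟩
    k * count (incident? (i , j)) coverOnce ≡⟨ count-concat-replicate (incident? (i , j)) k coverOnce ⟨
    count (incident? (i , j)) (copies k)    ∎)
    where open ℕ.≤-Reasoning

  length-copies : ∀ k → 2 * length (copies k) ≤ 3 * suc m * k + k
  length-copies k = begin
    2 * length (copies k)     ≡⟨ cong (2 *_) (trans (length-concat-replicate k coverOnce) (cong (k *_) length-coverOnce)) ⟩
    2 * (k * (q + (q + q)))   ≡⟨ regroup k q ⟩
    3 * ((q + q) * k)         ≤⟨ ℕ.*-monoʳ-≤ 3 (ℕ.*-monoˡ-≤ k (⌈m/2⌉+⌈m/2⌉≤1+m m)) ⟩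
    3 * (suc m * k)           ≡⟨ ℕ.*-assoc 3 (suc m) k ⟨
    3 * suc m * k             ≤⟨ ℕ.m≤m+n _ k ⟩
    3 * suc m * k + k         ∎
    where
      open ℕ.≤-Reasoning
      q : ℕ
      q = ⌈ m /2⌉
      regroup : ∀ k q → 2 * (k * (q + (q + q))) ≡ 3 * ((q + q) * k)
      regroup = solve-∀

  upperBound : ∀ k → Σ (List (Line R)) λ L →
    AvoidsVertex R a b L × KCover R a b k L × (2 * length L ≤ 3 * suc m * k + k)
  upperBound k = copies k , copies-avoidVertex k , copies-kCover k , length-copies k

open import Data.Nat using (_+_; _*_; _≤_)

theorem1p4 : (R : RealField) (n k : ℕ) → 1 ≤ n → 1 ≤ k →
    (a b : Fin n → RealField.Carrier R) →
    StrictlyIncreasing R a → StrictlyIncreasing R b → Generic R a b →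
    ((L : List (Line R)) → AvoidsVertex R a b L → KCover R a b k L →
      3 * n * k ≤ 2 * length L + 4 * k)
    × Σ (List (Line R)) (λ L → AvoidsVertex R a b L × KCover R a b k L ×
      (2 * length L ≤ 3 * n * k + k))
theorem1p4 R zero    k () _ a b a-inc b-inc generic
theorem1p4 R (suc m) k _ _ a b a-inc b-inc generic = lowerBound , upperBound k
  where open Bounds R a b a-inc b-inc generic
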